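{- Let $a$ be a non-zero integer, let $\square_2=\{u^2+v^2:\ u,v\in\mathbb{Z}\}$ and $S(\square_2,\square_2,a)=\{n\in\mathbb{Z}:\ n\in\square_2,\ n+a\in\square_2\}$. There exists a constant $C_a>0$ such that for every real $x\geq 1$ the interval $[x,\,x+C_a x^{1/2}]$ contains an element of $S(\square_2,\square_2,a)$.
   Formalization: The variable x ranges over rationals with $x\geq 1$ instead of reals, and the constant $C_a$ is taken rational. -}

module Defs where

open import Data.Integer using (ℤ; _+_; _*_)
open import Data.Rational using (ℚ; _/_)
open import Data.Product using (∃₂)
open import Relation.Binary.PropositionalEquality using (_≡_)

IsSumTwoSquares : ℤ → Set
IsSumTwoSquares n = ∃₂ λ (u v : ℤ) → n ≡ u * u + v * v

InS : ℤ → ℤ → Set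
InS a n = IsSumTwoSquares n Data.Product.× IsSumTwoSquares (n + a)
  where import Data.Product

toℚ : ℤ → ℚ
toℚ n = n / 1

{-# OPTIONS --safe #-}
-- If a ≢ 2 (mod 4) then a = d² − c², so m² + c² and m² + c² + a = m² + d² are sums
-- of two squares for every m; if a ≡ 2 (mod 4) then a = 2(d² − c²) and the same
-- holds for 2(m² + c²), because 2(u² + v²) = (u + v)² + (u − v)². Hence S(□₂, □₂, a)
-- contains the whole sequence k(m² + s) for some k ≥ 1 and s. Consecutive terms of
-- this sequence differ by k(2m + 1) = O(√(k m²)), so the first term that is ≥ x
-- exceeds x by O(√x).
module Submission where

open import Data.Nat as ℕ using (ℕ; zero; suc; NonZero)
import Data.Nat.Properties as ℕP
open import Data.Integer as ℤ using (ℤ; 0ℤ; +_; -[1+_]; ∣_∣)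
open import Data.Product using (Σ; ∃; ∃₂; _×_; _,_)
open import Data.Sum using (_⊎_; inj₁; inj₂)
open import Relation.Binary.PropositionalEquality
open import Defs

module SumsOfTwoSquares where

  open import Data.Integer using (_+_; _*_; _-_)
  open import Data.Integer.DivMod using (_%_; _/_; n%d<d; a≡a%n+[a/n]*n)
  open import Data.Integer.Properties using (pos-*; pos-+; +-assoc; *-distribˡ-+; *-identityˡ)
  open import Data.Integer.Tactic.RingSolver using (solve-∀)
  open ≡-Reasoning

  +∣i∣*∣i∣≡i*i : ∀ i → + (∣ i ∣ ℕ.* ∣ i ∣) ≡ i * i
  +∣i∣*∣i∣≡i*i (+ n)    = pos-* n n
  +∣i∣*∣i∣≡i*i -[1+ n ] = refl

  sumTwoSquares-double : ∀ {n} → IsSumTwoSquares n → IsSumTwoSquares (+ 2 * n)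
  sumTwoSquares-double (u , v , refl) = u + v , u - v , identity u v
    where
    identity : ∀ u v → + 2 * (u * u + v * v) ≡ (u + v) * (u + v) + (u - v) * (u - v)
    identity = solve-∀

  DifferenceOfSquares DoubledDifferenceOfSquares : ℤ → Set
  DifferenceOfSquares a        = ∃₂ λ c d → c * c + a ≡ d * d
  DoubledDifferenceOfSquares a = ∃₂ λ c d → + 2 * (c * c) + a ≡ + 2 * (d * d)

  differenceOfSquares-mod4 : ∀ r t → r ℕ.< 4 →
    DifferenceOfSquares (+ r + t * + 4) ⊎ DoubledDifferenceOfSquares (+ r + t * + 4)
  differenceOfSquares-mod4 0 t _ = inj₁ (t - + 1 , t + + 1 , identity t)
    where
    identity : ∀ t → (t - + 1) * (t - + 1) + (+ 0 + t * + 4) ≡ (t + + 1) * (t + + 1)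
    identity = solve-∀
  differenceOfSquares-mod4 1 t _ = inj₁ (+ 2 * t , + 2 * t + + 1 , identity t)
    where
    identity : ∀ t → (+ 2 * t) * (+ 2 * t) + (+ 1 + t * + 4) ≡ (+ 2 * t + + 1) * (+ 2 * t + + 1)
    identity = solve-∀
  differenceOfSquares-mod4 2 t _ = inj₂ (t , t + + 1 , identity t)
    where
    identity : ∀ t → + 2 * (t * t) + (+ 2 + t * + 4) ≡ + 2 * ((t + + 1) * (t + + 1))
    identity = solve-∀
  differenceOfSquares-mod4 3 t _ = inj₁ (+ 2 * t + + 1 , + 2 * t + + 2 , identity t)
    where
    identity : ∀ t → (+ 2 * t + + 1) * (+ 2 * t + + 1) + (+ 3 + t * + 4) ≡ (+ 2 * t + + 2) * (+ 2 * t + + 2)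
    identity = solve-∀
  differenceOfSquares-mod4 (suc (suc (suc (suc _)))) t (ℕ.s≤s (ℕ.s≤s (ℕ.s≤s (ℕ.s≤s ()))))

  differenceOfSquares⊎doubled : ∀ a → DifferenceOfSquares a ⊎ DoubledDifferenceOfSquares a
  differenceOfSquares⊎doubled a =
    subst (λ b → DifferenceOfSquares b ⊎ DoubledDifferenceOfSquares b) (sym (a≡a%n+[a/n]*n a (+ 4)))
          (differenceOfSquares-mod4 (a % + 4) (a / + 4) (n%d<d a (+ 4)))

  inS-shifted-square : ∀ {a} c d → c * c + a ≡ d * d → ∀ u → InS a (u * u + c * c)
  inS-shifted-square {a} c d c²+a≡d² u = (u , c , refl) , (u , d , u²+c²+a≡u²+d²)
    where
    u²+c²+a≡u²+d² : u * u + c * c + a ≡ u * u + d * d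
    u²+c²+a≡u²+d² = trans (+-assoc (u * u) (c * c) a) (cong (_+_ (u * u)) c²+a≡d²)

  inS-doubled-square : ∀ {a} c d → + 2 * (c * c) + a ≡ + 2 * (d * d) →
                       ∀ u → InS a (+ 2 * (u * u + c * c))
  inS-doubled-square {a} c d 2c²+a≡2d² u =
    sumTwoSquares-double (u , c , refl) ,
    subst IsSumTwoSquares (sym 2[u²+c²]+a≡2[u²+d²]) (sumTwoSquares-double (u , d , refl))
    where
    regroup : ∀ u c a → + 2 * (u * u + c * c) + a ≡ + 2 * (u * u) + (+ 2 * (c * c) + a)
    regroup = solve-∀
    2[u²+c²]+a≡2[u²+d²] : + 2 * (u * u + c * c) + a ≡ + 2 * (u * u + d * d)
    2[u²+c²]+a≡2[u²+d²] = begin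
      + 2 * (u * u + c * c) + a               ≡⟨ regroup u c a ⟩
      + 2 * (u * u) + (+ 2 * (c * c) + a)     ≡⟨ cong (_+_ (+ 2 * (u * u))) 2c²+a≡2d² ⟩
      + 2 * (u * u) + + 2 * (d * d)           ≡⟨ *-distribˡ-+ (+ 2) (u * u) (d * d) ⟨
      + 2 * (u * u + d * d)                   ∎

  quadratic : ℕ → ℕ → ℕ → ℕ
  quadratic k s m = k ℕ.* (m ℕ.* m ℕ.+ s)

  +quadratic : ∀ k c m → + quadratic k (∣ c ∣ ℕ.* ∣ c ∣) m ≡ + k * (+ m * + m + c * c)
  +quadratic k c m = begin
    + (k ℕ.* (m ℕ.* m ℕ.+ ∣ c ∣ ℕ.* ∣ c ∣))    ≡⟨ pos-* k _ ⟩
    + k * + (m ℕ.* m ℕ.+ ∣ c ∣ ℕ.* ∣ c ∣)      ≡⟨ cong (+ k *_) (pos-+ (m ℕ.* m) _) ⟩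
    + k * (+ (m ℕ.* m) + + (∣ c ∣ ℕ.* ∣ c ∣))  ≡⟨ cong₂ (λ u v → + k * (u + v)) (pos-* m m) (+∣i∣*∣i∣≡i*i c) ⟩
    + k * (+ m * + m + c * c)                 ∎

  record QuadraticFamily (a : ℤ) : Set where
    field
      k s : ℕ
      k≢0 : NonZero k
      inS : ∀ m → InS a (+ quadratic k s m)

  quadraticFamily : ∀ a → QuadraticFamily a
  quadraticFamily a with differenceOfSquares⊎doubled a
  ... | inj₁ (c , d , c²+a≡d²) = record
    { k = 1 ; s = ∣ c ∣ ℕ.* ∣ c ∣ ; k≢0 = _
    ; inS = λ m → subst (InS a) (sym (trans (+quadratic 1 c m) (*-identityˡ _)))
                        (inS-shifted-square c d c²+a≡d² (+ m))
    }
  ... | inj₂ (c , d , 2c²+a≡2d²) = record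
    { k = 2 ; s = ∣ c ∣ ℕ.* ∣ c ∣ ; k≢0 = _
    ; inS = λ m → subst (InS a) (sym (+quadratic 2 c m)) (inS-doubled-square c d 2c²+a≡2d² (+ m))
    }

module QuadraticGaps where

  open import Data.Nat using (_+_; _*_; _≤_; _≤?_; z≤n)
  open import Data.Nat.Properties
  open import Data.Nat.Tactic.RingSolver using (solve-∀)
  open import Relation.Nullary using (yes; no)
  open SumsOfTwoSquares using (quadratic)
  open ≤-Reasoning

  n≤n*n : ∀ n → n ≤ n * n
  n≤n*n zero      = z≤n
  n≤n*n n@(suc _) = m≤m*n n n

  [2n+1]²≤8n²+1 : ∀ n → (2 * n + 1) * (2 * n + 1) ≤ 8 * (n * n) + 1
  [2n+1]²≤8n²+1 n = begin
    (2 * n + 1) * (2 * n + 1)      ≡⟨ expand n ⟩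
    4 * (n * n) + 4 * n + 1        ≤⟨ +-monoˡ-≤ 1 (+-monoʳ-≤ (4 * (n * n)) (*-monoʳ-≤ 4 (n≤n*n n))) ⟩
    4 * (n * n) + 4 * (n * n) + 1  ≡⟨ collect n ⟩
    8 * (n * n) + 1                ∎
    where
    expand : ∀ n → (2 * n + 1) * (2 * n + 1) ≡ 4 * (n * n) + 4 * n + 1
    expand = solve-∀
    collect : ∀ n → 4 * (n * n) + 4 * (n * n) + 1 ≡ 8 * (n * n) + 1
    collect = solve-∀

  first-crossing : (g : ℕ → ℕ) {p : ℕ} (N : ℕ) → p ≤ g N →
                   p ≤ g 0 ⊎ ∃ λ j → g j ≤ p × p ≤ g (suc j)
  first-crossing g zero    p≤g0 = inj₁ p≤g0
  first-crossing g {p} (suc N) p≤gN+1 with p ≤? g N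
  ... | yes p≤gN = first-crossing g N p≤gN
  ... | no  p≰gN = inj₂ (N , <⇒≤ (≰⇒> p≰gN) , p≤gN+1)

  gapConstant : ℕ → ℕ → ℕ
  gapConstant k s = k * (8 + k + k * (s * s))

  gapConstant≡ : ∀ k s → gapConstant k s ≡ 8 * k + k * k + k * s * (k * s)
  gapConstant≡ k s = expand k s
    where
    expand : ∀ k s → k * (8 + k + k * (s * s)) ≡ 8 * k + k * k + k * s * (k * s)
    expand = solve-∀

  -- x = p / q is handled through the q-scaled values q k(m² + s), to stay in ℕ.
  module _ (k s q : ℕ) .{{_ : NonZero k}} .{{_ : NonZero q}} where

    value : ℕ → ℕ
    value m = quadratic k s m * q

    value-suc : ∀ j → value (suc j) ≡ value j + k * (2 * j + 1) * q
    value-suc j = identity k j s q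
      where
      identity : ∀ k j s q → k * ((1 + j) * (1 + j) + s) * q ≡ k * (j * j + s) * q + k * (2 * j + 1) * q
      identity = solve-∀

    n≤value[n] : ∀ n → n ≤ value n
    n≤value[n] n = begin
      n                    ≤⟨ n≤n*n n ⟩
      n * n                ≤⟨ m≤m+n (n * n) s ⟩
      n * n + s            ≤⟨ m≤n*m (n * n + s) k ⟩
      k * (n * n + s)      ≤⟨ m≤m*n (k * (n * n + s)) q ⟩
      value n              ∎

    overshoot-initial : ∀ {p r} → q ≤ p → p + r ≡ value 0 → r * r ≤ gapConstant k s * (q * p)
    overshoot-initial {p} {r} q≤p p+r≡ = begin
      r * r                                        ≤⟨ *-mono-≤ r≤ksq r≤ksq ⟩
      (k * s * q) * (k * s * q)                    ≡⟨ regroup k s q ⟩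
      k * s * (k * s) * (q * q)                    ≤⟨ *-monoʳ-≤ (k * s * (k * s)) (*-monoʳ-≤ q q≤p) ⟩
      k * s * (k * s) * (q * p)                    ≤⟨ *-monoˡ-≤ (q * p) (m≤n+m _ (8 * k + k * k)) ⟩
      (8 * k + k * k + k * s * (k * s)) * (q * p)  ≡⟨ cong (_* (q * p)) (gapConstant≡ k s) ⟨
      gapConstant k s * (q * p)                    ∎
      where
      r≤ksq : r ≤ k * s * q
      r≤ksq = subst (r ≤_) p+r≡ (m≤n+m r p)
      regroup : ∀ k s q → (k * s * q) * (k * s * q) ≡ k * s * (k * s) * (q * q)
      regroup = solve-∀

    overshoot-later : ∀ {p r} j → q ≤ p → value j ≤ p → p + r ≡ value (suc j) →
                      r * r ≤ gapConstant k s * (q * p)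
    overshoot-later {p} {r} j q≤p vj≤p p+r≡ = begin
      r * r                                            ≤⟨ *-mono-≤ r≤gap r≤gap ⟩
      gap * gap                                        ≡⟨ expand k j q ⟩
      k * k * ((2 * j + 1) * (2 * j + 1)) * (q * q)    ≤⟨ *-monoˡ-≤ (q * q) (*-monoʳ-≤ (k * k) ([2n+1]²≤8n²+1 j)) ⟩
      k * k * (8 * (j * j) + 1) * (q * q)              ≡⟨ regroup k j q ⟩
      8 * k * (k * (j * j) * q) * q + k * k * (q * q)  ≤⟨ +-mono-≤ (*-monoˡ-≤ q (*-monoʳ-≤ (8 * k) kj²q≤p))
                                                                   (*-monoʳ-≤ (k * k) (*-monoʳ-≤ q q≤p)) ⟩
      8 * k * p * q + k * k * (q * p)                  ≡⟨ collect k p q ⟩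
      (8 * k + k * k) * (q * p)                        ≤⟨ *-monoˡ-≤ (q * p) (m≤m+n (8 * k + k * k) _) ⟩
      (8 * k + k * k + k * s * (k * s)) * (q * p)      ≡⟨ cong (_* (q * p)) (gapConstant≡ k s) ⟨
      gapConstant k s * (q * p)                        ∎
      where
      gap = k * (2 * j + 1) * q
      r≤gap : r ≤ gap
      r≤gap = +-cancelˡ-≤ (value j) r gap (begin
        value j + r  ≤⟨ +-monoˡ-≤ r vj≤p ⟩
        p + r        ≡⟨ p+r≡ ⟩
        value (suc j) ≡⟨ value-suc j ⟩
        value j + gap ∎)
      kj²q≤p : k * (j * j) * q ≤ p
      kj²q≤p = ≤-trans (*-monoˡ-≤ q (*-monoʳ-≤ k (m≤m+n (j * j) s))) vj≤p
      expand : ∀ k j q → (k * (2 * j + 1) * q) * (k * (2 * j + 1) * q) ≡ k * k * ((2 * j + 1) * (2 * j + 1)) * (q * q)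
      expand = solve-∀
      regroup : ∀ k j q → k * k * (8 * (j * j) + 1) * (q * q) ≡ 8 * k * (k * (j * j) * q) * q + k * k * (q * q)
      regroup = solve-∀
      collect : ∀ k p q → 8 * k * p * q + k * k * (q * p) ≡ (8 * k + k * k) * (q * p)
      collect = solve-∀

    square-gapConstant : ∀ n → gapConstant k s * n ≤ gapConstant k s * gapConstant k s * n
    square-gapConstant n = *-monoˡ-≤ n (n≤n*n (gapConstant k s))

    overshoot : ∀ p → q ≤ p →
                ∃₂ λ m r → p + r ≡ value m × r * r ≤ gapConstant k s * gapConstant k s * (q * p)
    overshoot p q≤p with first-crossing value p (n≤value[n] p)
    ... | inj₁ p≤v0 with r , p+r≡ ← m≤n⇒∃[o]m+o≡n p≤v0 =
      0 , r , p+r≡ , ≤-trans (overshoot-initial q≤p p+r≡) (square-gapConstant (q * p))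
    ... | inj₂ (j , vj≤p , p≤vj+1) with r , p+r≡ ← m≤n⇒∃[o]m+o≡n p≤vj+1 =
      suc j , r , p+r≡ , ≤-trans (overshoot-later j q≤p vj≤p p+r≡) (square-gapConstant (q * p))

open import Data.Rational as ℚ using (ℚ; mkℚ; 0ℚ; 1ℚ; _≤_; _<_; _*_; _-_; _+_; Positive; ↥_; ↧_; ↧ₙ_; toℚᵘ)
import Data.Rational.Properties as ℚP
open import Data.Rational.Solver using (module +-*-Solver)
open import Data.Rational.Unnormalised as ℚᵘ using (mkℚᵘ; *≡*; *≤*)
import Data.Rational.Unnormalised.Properties as ℚᵘP
import Data.Integer.Properties as ℤP
import Data.Integer.Tactic.RingSolver as ℤ-Solver
open import Relation.Binary.Bundles using (DecTotalOrder)
import Relation.Binary.Reasoning.PartialOrder as PartialOrderReasoning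

toℚᵘ-toℚ : ∀ i → toℚᵘ (toℚ i) ℚᵘ.≃ mkℚᵘ i 0
toℚᵘ-toℚ i = ℚP.toℚᵘ-fromℚᵘ (mkℚᵘ i 0)

toℚ-+ : ∀ m n → toℚ (m ℤ.+ n) ≡ toℚ m + toℚ n
toℚ-+ m n = ℚP.toℚᵘ-injective (begin
  toℚᵘ (toℚ (m ℤ.+ n))             ≈⟨ toℚᵘ-toℚ (m ℤ.+ n) ⟩
  mkℚᵘ (m ℤ.+ n) 0                 ≈⟨ *≡* (identity m n) ⟩
  mkℚᵘ m 0 ℚᵘ.+ mkℚᵘ n 0           ≈⟨ ℚᵘP.+-cong (toℚᵘ-toℚ m) (toℚᵘ-toℚ n) ⟨
  toℚᵘ (toℚ m) ℚᵘ.+ toℚᵘ (toℚ n)   ≈⟨ ℚP.toℚᵘ-homo-+ (toℚ m) (toℚ n) ⟨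
  toℚᵘ (toℚ m + toℚ n)             ∎)
  where
  open ℚᵘP.≃-Reasoning
  identity : ∀ m n → (m ℤ.+ n) ℤ.* + 1 ≡ (m ℤ.* + 1 ℤ.+ n ℤ.* + 1) ℤ.* + 1
  identity = ℤ-Solver.solve-∀

toℚ-* : ∀ m n → toℚ (m ℤ.* n) ≡ toℚ m * toℚ n
toℚ-* m n = ℚP.toℚᵘ-injective (begin
  toℚᵘ (toℚ (m ℤ.* n))             ≈⟨ toℚᵘ-toℚ (m ℤ.* n) ⟩
  mkℚᵘ m 0 ℚᵘ.* mkℚᵘ n 0           ≈⟨ ℚᵘP.*-cong (toℚᵘ-toℚ m) (toℚᵘ-toℚ n) ⟨
  toℚᵘ (toℚ m) ℚᵘ.* toℚᵘ (toℚ n)   ≈⟨ ℚP.toℚᵘ-homo-* (toℚ m) (toℚ n) ⟨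
  toℚᵘ (toℚ m * toℚ n)             ∎)
  where open ℚᵘP.≃-Reasoning

toℚ-mono-≤ : ∀ {m n} → m ℤ.≤ n → toℚ m ≤ toℚ n
toℚ-mono-≤ {m} {n} m≤n = ℚP.toℚᵘ-cancel-≤ (begin
  toℚᵘ (toℚ m)  ≃⟨ toℚᵘ-toℚ m ⟩
  mkℚᵘ m 0      ≤⟨ *≤* (ℤP.*-monoʳ-≤-nonNeg (+ 1) m≤n) ⟩
  mkℚᵘ n 0      ≃⟨ toℚᵘ-toℚ n ⟨
  toℚᵘ (toℚ n)  ∎)
  where open ℚᵘP.≤-Reasoning

toℚ[↧x]*x≡toℚ[↥x] : ∀ x → toℚ (↧ x) * x ≡ toℚ (↥ x)
toℚ[↧x]*x≡toℚ[↥x] x@(mkℚ n d-1 _) = ℚP.toℚᵘ-injective (begin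
  toℚᵘ (toℚ (↧ x) * x)            ≈⟨ ℚP.toℚᵘ-homo-* (toℚ (↧ x)) x ⟩
  toℚᵘ (toℚ (↧ x)) ℚᵘ.* toℚᵘ x    ≈⟨ ℚᵘP.*-congʳ (toℚᵘ-toℚ (↧ x)) ⟩
  mkℚᵘ (↧ x) 0 ℚᵘ.* mkℚᵘ n d-1    ≈⟨ *≡* (identity n (suc d-1)) ⟩
  mkℚᵘ n 0                         ≈⟨ toℚᵘ-toℚ n ⟨
  toℚᵘ (toℚ n)                     ∎)
  where
  open ℚᵘP.≃-Reasoning
  identity : ∀ n d → (+ d ℤ.* n) ℤ.* + 1 ≡ n ℤ.* + (1 ℕ.* d)
  identity n d = trans (commute n (+ d)) (cong (λ e → n ℤ.* + e) (sym (ℕP.*-identityˡ d)))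
    where
    commute : ∀ n d → (d ℤ.* n) ℤ.* + 1 ≡ n ℤ.* d
    commute = ℤ-Solver.solve-∀

fromℕ : ℕ → ℚ
fromℕ n = toℚ (+ n)

fromℕ-+ : ∀ m n → fromℕ (m ℕ.+ n) ≡ fromℕ m + fromℕ n
fromℕ-+ m n = trans (cong toℚ (ℤP.pos-+ m n)) (toℚ-+ (+ m) (+ n))

fromℕ-* : ∀ m n → fromℕ (m ℕ.* n) ≡ fromℕ m * fromℕ n
fromℕ-* m n = trans (cong toℚ (ℤP.pos-* m n)) (toℚ-* (+ m) (+ n))

fromℕ-mono-≤ : ∀ {m n} → m ℕ.≤ n → fromℕ m ≤ fromℕ n
fromℕ-mono-≤ m≤n = toℚ-mono-≤ (ℤ.+≤+ m≤n)

fromℕ-pos : ∀ n .{{_ : NonZero n}} → Positive (fromℕ n)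
fromℕ-pos n = ℚP.normalize-pos n 1

scaled-window : ∀ {D x N P R B} .{{_ : Positive D}} → 0ℚ ≤ R →
                D * x ≡ P → D * N ≡ P + R → R * R ≤ B * (D * P) →
                x ≤ N × (N - x) * (N - x) ≤ B * x
scaled-window {D} {x} {N} {P} {R} {B} 0≤R Dx≡P DN≡P+R R²≤BDP = x≤N , [N-x]²≤Bx
  where
  open PartialOrderReasoning (DecTotalOrder.poset ℚP.≤-decTotalOrder)
  open +-*-Solver
  x≤N : x ≤ N
  x≤N = ℚP.*-cancelˡ-≤-pos D (begin
    D * x    ≡⟨ trans Dx≡P (sym (ℚP.+-identityʳ P)) ⟩
    P + 0ℚ   ≤⟨ ℚP.+-monoʳ-≤ P 0≤R ⟩
    P + R    ≡⟨ DN≡P+R ⟨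
    D * N    ∎)
  [N-x]²≤Bx : (N - x) * (N - x) ≤ B * x
  [N-x]²≤Bx = ℚP.*-cancelˡ-≤-pos D (ℚP.*-cancelˡ-≤-pos D (begin
    D * (D * ((N - x) * (N - x)))        ≡⟨ distribute D N x ⟩
    (D * N - D * x) * (D * N - D * x)    ≡⟨ cong₂ (λ u v → (u - v) * (u - v)) DN≡P+R Dx≡P ⟩
    (P + R - P) * (P + R - P)            ≡⟨ cancel P R ⟩
    R * R                                ≤⟨ R²≤BDP ⟩
    B * (D * P)                          ≡⟨ cong (λ y → B * (D * y)) Dx≡P ⟨
    B * (D * (D * x))                    ≡⟨ commute B D x ⟩
    D * (D * (B * x))                    ∎))
    where
    distribute : ∀ D N x → D * (D * ((N - x) * (N - x))) ≡ (D * N - D * x) * (D * N - D * x)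
    distribute = solve 3 (λ D N x → D :* (D :* ((N :- x) :* (N :- x))) := (D :* N :- D :* x) :* (D :* N :- D :* x)) refl
    cancel : ∀ P R → (P + R - P) * (P + R - P) ≡ R * R
    cancel = solve 2 (λ P R → (P :+ R :- P) :* (P :+ R :- P) := R :* R) refl
    commute : ∀ B D x → B * (D * (D * x)) ≡ D * (D * (B * x))
    commute = solve 3 (λ B D x → B :* (D :* (D :* x)) := D :* (D :* (B :* x))) refl

fromℕ-window : ∀ x {p n r E} → ↥ x ≡ + p → p ℕ.+ r ≡ n ℕ.* ↧ₙ x → r ℕ.* r ℕ.≤ E ℕ.* E ℕ.* (↧ₙ x ℕ.* p) →
               x ≤ fromℕ n × (fromℕ n - x) * (fromℕ n - x) ≤ fromℕ E * fromℕ E * x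
fromℕ-window x {p} {n} {r} {E} ↥x≡p p+r≡nq r²≤ =
  scaled-window {fromℕ q} {x} {fromℕ n} {fromℕ p} {fromℕ r} {fromℕ E * fromℕ E} {{fromℕ-pos q}}
                (fromℕ-mono-≤ {n = r} ℕ.z≤n) qx≡p qn≡p+r (subst₂ _≤_ (fromℕ-* r r) E²qp≡ (fromℕ-mono-≤ r²≤))
  where
  open ≡-Reasoning
  q = ↧ₙ x
  qx≡p : fromℕ q * x ≡ fromℕ p
  qx≡p = trans (toℚ[↧x]*x≡toℚ[↥x] x) (cong toℚ ↥x≡p)
  qn≡p+r : fromℕ q * fromℕ n ≡ fromℕ p + fromℕ r
  qn≡p+r = begin
    fromℕ q * fromℕ n     ≡⟨ fromℕ-* q n ⟨
    fromℕ (q ℕ.* n)       ≡⟨ cong fromℕ (trans (ℕP.*-comm q n) (sym p+r≡nq)) ⟩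
    fromℕ (p ℕ.+ r)       ≡⟨ fromℕ-+ p r ⟩
    fromℕ p + fromℕ r     ∎
  E²qp≡ : fromℕ (E ℕ.* E ℕ.* (q ℕ.* p)) ≡ fromℕ E * fromℕ E * (fromℕ q * fromℕ p)
  E²qp≡ = trans (fromℕ-* (E ℕ.* E) (q ℕ.* p)) (cong₂ _*_ (fromℕ-* E E) (fromℕ-* q p))

1≤x⇒↧x≤↥x : ∀ {x} → 1ℚ ≤ x → ↧ x ℤ.≤ ↥ x
1≤x⇒↧x≤↥x (ℚ.*≤* 1*q≤p*1) = subst₂ ℤ._≤_ (ℤP.*-identityˡ _) (ℤP.*-identityʳ _) 1*q≤p*1

open SumsOfTwoSquares using (QuadraticFamily; quadraticFamily; quadratic)
open QuadraticGaps using (gapConstant; overshoot)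

lemma1p2 : (a : ℤ) → a ≢ 0ℤ →
    Σ ℚ λ C → 0ℚ < C ×
      ((x : ℚ) → 1ℚ ≤ x →
        ∃ λ (n : ℤ) → x ≤ toℚ n × (toℚ n - x) * (toℚ n - x) ≤ C * C * x × InS a n)
lemma1p2 a _ = fromℕ E , ℚP.positive⁻¹ (fromℕ E) {{fromℕ-pos E {{ℕP.m*n≢0 k _ {{k≢0}}}}}} , window
  where
  open QuadraticFamily (quadraticFamily a)
  E = gapConstant k s
  window : (x : ℚ) → 1ℚ ≤ x →
           ∃ λ n → x ≤ toℚ n × (toℚ n - x) * (toℚ n - x) ≤ fromℕ E * fromℕ E * x × InS a n
  window x@(mkℚ (+ p) _ _) 1≤x =
    let m , r , p+r≡ , r²≤ = overshoot k s (↧ₙ x) {{k≢0}} p (ℤP.drop‿+≤+ (1≤x⇒↧x≤↥x 1≤x))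
        x≤n , [n-x]²≤ = fromℕ-window x {p} {quadratic k s m} {r} {E} refl p+r≡ r²≤
    in + quadratic k s m , x≤n , [n-x]²≤ , inS m
  window (mkℚ -[1+ _ ] _ _) (ℚ.*≤* ())
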